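{- Let $m\ge1$ be an integer and let $X,Y$ be non-empty subsets of $\mathbb Z/m\mathbb Z$. Put $\delta:=\min(\delta_X,\delta_Y)$. Then $|X+Y|\ge\min(\delta^{ -1}m,|X|+|Y|-1)$. In particular, $|X+Y|\ge\min(m,|X|+|Y|-1)$ if there exists $y_0\in Y$ such that $\gcd(m,y-y_0)=1$ for every $y\in Y\setminus\{y_0\}$ (and likewise if there exists $x_0\in X$ with $\gcd(m,x-x_0)=1$ for all $x\in X\setminus\{x_0\}$).
   Context: For a non-empty $Z\subseteq\mathbb Z/m\mathbb Z$, $\delta_Z:=\min_{z_0\in Z}\max_{z\in Z\setminus\{z_0\}}\gcd(m,z-z_0)$ if $|Z|\ge2$, and $\delta_Z:=1$ if $|Z|=1$. $X+Y$ is the sumset in the additive group $\mathbb Z/m\mathbb Z$. -}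

module Defs where

open import Data.Bool using (Bool; true; false; _∧_; if_then_else_; not)
open import Data.Nat using (ℕ; zero; suc; _+_; _*_; _∸_; _≤_; _⊔_; _⊓_; _≡ᵇ_; NonZero)
open import Data.Nat.DivMod using (_mod_)
open import Data.Nat.GCD using (gcd)
open import Data.Fin using (Fin; toℕ)
open import Data.Fin.Properties using (_≟_)
open import Data.Fin.Subset using (Subset; ∣_∣)
open import Data.List using (List; allFin; filter; map; foldr)
open import Data.Bool.ListAction using (any)
open import Data.Vec using (lookup; tabulate)
open import Relation.Nullary.Decidable using (⌊_⌋)
open import Data.Bool.Properties using () renaming (_≟_ to _≟ᵇ_)

-- The group ℤ/mℤ is modelled as Fin m (m ≥ 1), residues 0 … m-1.

_∈ᵇ_ : ∀ {m} → Fin m → Subset m → Bool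
x ∈ᵇ Z = lookup Z x

addMod : (m : ℕ) .{{_ : NonZero m}} → Fin m → Fin m → Fin m
addMod m x y = (toℕ x + toℕ y) mod m

subMod : (m : ℕ) .{{_ : NonZero m}} → Fin m → Fin m → Fin m
subMod m z z₀ = (toℕ z + (m ∸ toℕ z₀)) mod m

gcdDiff : (m : ℕ) .{{_ : NonZero m}} → Fin m → Fin m → ℕ
gcdDiff m z z₀ = gcd m (toℕ (subMod m z z₀))

sumset : (m : ℕ) .{{_ : NonZero m}} → Subset m → Subset m → Subset m
sumset m X Y = tabulate λ k →
  any (λ x → any (λ y → (x ∈ᵇ X) ∧ ((y ∈ᵇ Y) ∧ ⌊ addMod m x y ≟ k ⌋)) (allFin m)) (allFin m)

elems : ∀ {m} → Subset m → List (Fin m)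
elems {m} Z = filter (λ z → z ∈ᵇ Z ≟ᵇ true) (allFin m)

maxGcd : (m : ℕ) .{{_ : NonZero m}} → Subset m → Fin m → ℕ
maxGcd m Z z₀ = foldr _⊔_ 0
  (map (λ z → if ⌊ z ≟ z₀ ⌋ then 0 else gcdDiff m z z₀) (elems Z))

-- δ_Z := min_{z₀ ∈ Z} max_{z ∈ Z \ {z₀}} gcd(m, z - z₀) if |Z| ≥ 2, and δ_Z := 1 if |Z| = 1.
-- (For |Z| ≥ 2 every inner max lies in [1, m], so starting the min-fold at m is harmless.)
δ : (m : ℕ) .{{_ : NonZero m}} → Subset m → ℕ
δ m Z = if ∣ Z ∣ ≡ᵇ 1 then 1 else foldr _⊓_ m (map (maxGcd m Z) (elems Z))

-- Dyson's e-transform, by induction on |Y|.  Call y₀ ∈ Y a d-anchor of Y if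
-- gcd(m, y − y₀) ≤ d for every other y ∈ Y; by definition Y has a δ_Y-anchor.
-- If some x ∈ X, z ∈ Y have z + (x − y₀) ∉ X, the e-transform with e = x − y₀,
-- (X, Y) ↦ (X ∪ (Y + e), Y ∩ (X − e)), preserves |X| + |Y| and the anchor y₀, removes z
-- from Y and does not enlarge X + Y.  Otherwise X is invariant under translation by
-- y − y₀ for every y ∈ Y.  If some y ≠ y₀, the orbits of that translation have
-- m / gcd(m, y − y₀) ≥ m / d elements, so d·|X + Y| ≥ d·|X| ≥ m; if Y = {y₀} the bound
-- is trivial.  As X + Y = Y + X, an anchor of X serves equally well.

module Submission where

open import Defs
open import Data.Bool using (Bool; true; false; T; _∧_; if_then_else_)
open import Data.Bool.Properties using (T-≡; T-∧) renaming (_≟_ to _≟ᵇ_)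
open import Data.Fin using (Fin; toℕ) renaming (zero to fzero; suc to fsuc)
open import Data.Fin.Properties
  using (suc-injective; 0≢1+n; toℕ-injective; toℕ-fromℕ<; toℕ<n; _≟_; any?)
open import Data.Fin.Subset
  using (Subset; ∣_∣; _∈_; _∉_; _∪_; _∩_; _-_; _⊆_; ⊤; ⁅_⁆; Nonempty; inside; outside)
open import Data.Fin.Subset.Properties
  using (x∈p∧x≢y⇒x∈p-y; x∈p⇒∣p-x∣<∣p∣; ⊆-antisym; p⊆q⇒∣p∣≤∣q∣; p⊂q⇒∣p∣<∣q∣; p∩q⊆p;
         x∈p∩q⁺; x∈p∩q⁻; x∈p∪q⁺; x∈p∪q⁻; _∈?_; x∈⁅x⁆; ∣⁅x⁆∣≡1; ∣⊤∣≡n)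
open import Data.List using ([]; _∷_; map; foldr; allFin)
open import Data.List.Membership.Propositional using () renaming (_∈_ to _∈ˡ_)
open import Data.List.Membership.Propositional.Properties using (∈-allFin; ∈-filter⁺; ∈-filter⁻)
open import Data.List.Relation.Unary.Any using (here; there; satisfied) renaming (map to anyMap)
open import Data.List.Relation.Unary.Any.Properties using (any⁺; any⁻)
open import Data.Nat
  using (ℕ; zero; suc; _+_; _*_; _∸_; _≤_; _<_; _⊓_; _⊔_; _≡ᵇ_; NonZero; z≤n;
         ≢-nonZero; ≢-nonZero⁻¹; >-nonZero)
open import Data.Nat.DivMod
  using (_mod_; _%_; _/_; m%n<n; m<n⇒m%n≡m; %-distribˡ-+; m%n%n≡m%n; [m+n]%n≡m%n; m≡m%n+[m/n]*n)
open import Data.Nat.Divisibility using (_∣_; divides; ∣m+n∣m⇒∣n; n∣m*n; *-cancelʳ-∣; ∣⇒≤)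
open import Data.Nat.GCD using (gcd; gcd[m,n]∣m; gcd-greatest; c*gcd[m,n]≡gcd[cm,cn]; gcd[m,n]≢0)
open import Data.Nat.Properties
  using (≤-refl; ≤-reflexive; ≤-trans; ≤-antisym; ≤-<-trans; ≤-pred; <⇒≤; <⇒≱; >⇒≢; <-cmp; ≡ᵇ⇒≡;
         +-comm; +-assoc; +-suc; +-identityʳ; +-cancelˡ-≡; +-monoʳ-≤; *-comm; *-identityˡ;
         *-distribʳ-+; *-monoˡ-≤; *-monoʳ-≤; m∸n+n≡m; m+[n∸m]≡n; m+n∸n≡m; m<n⇒0<n∸m; m∸n≤m;
         ∸-monoˡ-≤; m≤m⊔n; m≤n⇒m≤o⊔n; m⊓n≤m; m⊓n≤n; ⊓-sel; module ≤-Reasoning)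
open import Data.Product using (_×_; _,_; ∃-syntax; proj₂)
open import Data.Sum using (_⊎_; inj₁; inj₂)
open import Data.Vec using (_∷_; []; here; there; lookup; tabulate)
open import Data.Vec.Properties using (lookup∘tabulate; []=⇒lookup; lookup⇒[]=)
open import Function using (_∘_)
open import Function.Bundles using (module Equivalence)
open import Function.Consequences.Propositional using (inverseʳ⇒injective; strictlyInverseʳ⇒inverseʳ)
open import Function.Definitions using (Injective; StrictlyInverseˡ; StrictlyInverseʳ)
open import Relation.Binary.Definitions using (tri<; tri≈; tri>)
open import Relation.Binary.PropositionalEquality
open import Relation.Nullary using (yes; no; contradiction)
open import Relation.Nullary.Decidable
  using (⌊_⌋; toWitness; fromWitness; _×-dec_; ¬?; decidable-stable)

open Equivalence using (to; from)

injection⇒∣p∣≤∣q∣ : ∀ {k n} {p : Subset k} {q : Subset n} (f : Fin k → Fin n) →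
  Injective _≡_ _≡_ f → (∀ {i} → i ∈ p → f i ∈ q) → ∣ p ∣ ≤ ∣ q ∣
injection⇒∣p∣≤∣q∣ {p = []} f f-inj f∈q = z≤n
injection⇒∣p∣≤∣q∣ {p = outside ∷ p} f f-inj f∈q =
  injection⇒∣p∣≤∣q∣ (f ∘ fsuc) (suc-injective ∘ f-inj) (f∈q ∘ there)
injection⇒∣p∣≤∣q∣ {p = inside ∷ p} {q} f f-inj f∈q = begin-strict
  ∣ p ∣         ≤⟨ injection⇒∣p∣≤∣q∣ (f ∘ fsuc) (suc-injective ∘ f-inj) f∈q-f0 ⟩
  ∣ q - f fzero ∣ <⟨ x∈p⇒∣p-x∣<∣p∣ (f∈q here) ⟩
  ∣ q ∣         ∎
  where
  open ≤-Reasoning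
  f∈q-f0 : ∀ {i} → i ∈ p → f (fsuc i) ∈ q - f fzero
  f∈q-f0 i∈p = x∈p∧x≢y⇒x∈p-y (f∈q (there i∈p)) (0≢1+n ∘ sym ∘ f-inj)

∣p∪q∣+∣p∩q∣≡∣p∣+∣q∣ : ∀ {n} (p q : Subset n) → ∣ p ∪ q ∣ + ∣ p ∩ q ∣ ≡ ∣ p ∣ + ∣ q ∣
∣p∪q∣+∣p∩q∣≡∣p∣+∣q∣ []            []            = refl
∣p∪q∣+∣p∩q∣≡∣p∣+∣q∣ (outside ∷ p) (outside ∷ q) = ∣p∪q∣+∣p∩q∣≡∣p∣+∣q∣ p q
∣p∪q∣+∣p∩q∣≡∣p∣+∣q∣ (inside ∷ p)  (outside ∷ q) = cong suc (∣p∪q∣+∣p∩q∣≡∣p∣+∣q∣ p q)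
∣p∪q∣+∣p∩q∣≡∣p∣+∣q∣ (outside ∷ p) (inside ∷ q)  =
  trans (cong suc (∣p∪q∣+∣p∩q∣≡∣p∣+∣q∣ p q)) (sym (+-suc ∣ p ∣ ∣ q ∣))
∣p∪q∣+∣p∩q∣≡∣p∣+∣q∣ (inside ∷ p)  (inside ∷ q)  =
  cong suc (trans (+-suc ∣ p ∪ q ∣ ∣ p ∩ q ∣)
                  (trans (cong suc (∣p∪q∣+∣p∩q∣≡∣p∣+∣q∣ p q)) (sym (+-suc ∣ p ∣ ∣ q ∣))))

x∈p∧y∈p∧x≢y⇒1<∣p∣ : ∀ {n} {p : Subset n} {x y} → x ∈ p → y ∈ p → x ≢ y → 1 < ∣ p ∣
x∈p∧y∈p∧x≢y⇒1<∣p∣ {p = p} {y = y} x∈p y∈p x≢y = begin-strict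
  1          ≤⟨ ≤-<-trans z≤n (x∈p⇒∣p-x∣<∣p∣ (x∈p∧x≢y⇒x∈p-y x∈p x≢y)) ⟩
  ∣ p - y ∣  <⟨ x∈p⇒∣p-x∣<∣p∣ y∈p ⟩
  ∣ p ∣      ∎
  where open ≤-Reasoning

∈-tabulate⁺ : ∀ {n} {f : Fin n → Bool} {i} → f i ≡ true → i ∈ tabulate f
∈-tabulate⁺ {f = f} {i} fi = lookup⇒[]= i (tabulate f) (trans (lookup∘tabulate f i) fi)

∈-tabulate⁻ : ∀ {n} {f : Fin n → Bool} {i} → i ∈ tabulate f → f i ≡ true
∈-tabulate⁻ {f = f} {i} i∈ = trans (sym (lookup∘tabulate f i)) ([]=⇒lookup i∈)

T-lookup⇒∈ : ∀ {n} {p : Subset n} {i} → T (lookup p i) → i ∈ p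
T-lookup⇒∈ {p = p} {i} t = lookup⇒[]= i p (to T-≡ t)

∈⇒T-lookup : ∀ {n} {p : Subset n} {i} → i ∈ p → T (lookup p i)
∈⇒T-lookup i∈p = from T-≡ ([]=⇒lookup i∈p)

preimage : ∀ {k n} → (Fin k → Fin n) → Subset n → Subset k
preimage f q = tabulate (lookup q ∘ f)

module _ {k n} (f : Fin k → Fin n) {q : Subset n} where

  ∈-preimage⁺ : ∀ {i} → f i ∈ q → i ∈ preimage f q
  ∈-preimage⁺ fi∈q = ∈-tabulate⁺ ([]=⇒lookup fi∈q)

  ∈-preimage⁻ : ∀ {i} → i ∈ preimage f q → f i ∈ q
  ∈-preimage⁻ {i} i∈ = lookup⇒[]= (f i) q (∈-tabulate⁻ i∈)

∣preimage∣≡∣q∣ : ∀ {n} {q : Subset n} (f g : Fin n → Fin n) →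
  StrictlyInverseˡ _≡_ f g → StrictlyInverseʳ _≡_ f g → ∣ preimage f q ∣ ≡ ∣ q ∣
∣preimage∣≡∣q∣ {q = q} f g f∘g≗id g∘f≗id = ≤-antisym
  (injection⇒∣p∣≤∣q∣ f (inverseʳ⇒injective {f⁻¹ = g} f (strictlyInverseʳ⇒inverseʳ f g∘f≗id))
    (∈-preimage⁻ f {q}))
  (injection⇒∣p∣≤∣q∣ g (inverseʳ⇒injective {f⁻¹ = f} g (strictlyInverseʳ⇒inverseʳ g f∘g≗id))
    g∈preimage)
  where
  g∈preimage : ∀ {i} → i ∈ q → g i ∈ preimage f q
  g∈preimage {i} i∈q = ∈-preimage⁺ f (subst (_∈ q) (sym (f∘g≗id i)) i∈q)

foldr-⊓-selective : ∀ {A : Set} (f : A → ℕ) e xs →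
  foldr _⊓_ e (map f xs) ≡ e ⊎ ∃[ x ] (x ∈ˡ xs × foldr _⊓_ e (map f xs) ≡ f x)
foldr-⊓-selective f e [] = inj₁ refl
foldr-⊓-selective f e (x ∷ xs) with ⊓-sel (f x) (foldr _⊓_ e (map f xs))
... | inj₁ min≡fx = inj₂ (x , here refl , min≡fx)
... | inj₂ min≡rest with foldr-⊓-selective f e xs
...   | inj₁ rest≡e             = inj₁ (trans min≡rest rest≡e)
...   | inj₂ (y , y∈xs , rest≡fy) = inj₂ (y , there y∈xs , trans min≡rest rest≡fy)

∈⇒≤foldr-⊔ : ∀ {A : Set} (f : A → ℕ) xs {x} → x ∈ˡ xs → f x ≤ foldr _⊔_ 0 (map f xs)
∈⇒≤foldr-⊔ f (y ∷ xs) (here refl)  = m≤m⊔n (f y) _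
∈⇒≤foldr-⊔ f (y ∷ xs) (there x∈xs) = m≤n⇒m≤o⊔n (f y) (∈⇒≤foldr-⊔ f xs x∈xs)

m%d≡[m+n]%d⇒d∣n : ∀ m n {d} .{{_ : NonZero d}} → m % d ≡ (m + n) % d → d ∣ n
m%d≡[m+n]%d⇒d∣n m n {d} m≡m+n =
  ∣m+n∣m⇒∣n (divides ((m + n) / d) m/d*d+n≡[m+n]/d*d) (n∣m*n (m / d))
  where
  open ≡-Reasoning
  m/d*d+n≡[m+n]/d*d : (m / d) * d + n ≡ ((m + n) / d) * d
  m/d*d+n≡[m+n]/d*d = +-cancelˡ-≡ (m % d) _ _ (begin
    m % d + ((m / d) * d + n)     ≡⟨ +-assoc (m % d) _ n ⟨
    (m % d + (m / d) * d) + n     ≡⟨ cong (_+ n) (m≡m%n+[m/n]*n m d) ⟨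
    m + n                         ≡⟨ m≡m%n+[m/n]*n (m + n) d ⟩
    (m + n) % d + ((m + n) / d) * d ≡⟨ cong (_+ ((m + n) / d) * d) m≡m+n ⟨
    m % d + ((m + n) / d) * d     ∎)

m≡q*gcd[m,n]⇒m∣k*n⇒q∣k : ∀ {m n k q} .{{_ : NonZero m}} → m ≡ q * gcd m n → m ∣ k * n → q ∣ k
m≡q*gcd[m,n]⇒m∣k*n⇒q∣k {m} {n} {k} m≡q*g m∣kn =
  *-cancelʳ-∣ (gcd m n) (subst (_∣ k * gcd m n) m≡q*g m∣k*g)
  where
  instance
    gcd≢0 : NonZero (gcd m n)
    gcd≢0 = ≢-nonZero (gcd[m,n]≢0 m n (inj₁ (≢-nonZero⁻¹ m)))
  m∣k*g : m ∣ k * gcd m n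
  m∣k*g = subst (m ∣_) (sym (c*gcd[m,n]≡gcd[cm,cn] k m n)) (gcd-greatest (n∣m*n k) m∣kn)

module _ {m : ℕ} .{{_ : NonZero m}} where

  infixl 6 _⊕_ _⊖_

  _⊕_ : Fin m → Fin m → Fin m
  _⊕_ = addMod m

  _⊖_ : Fin m → Fin m → Fin m
  _⊖_ = subMod m

  ⟦_⟧ : ℕ → Fin m
  ⟦ a ⟧ = a mod m

  toℕ⟦a⟧≡a%m : ∀ a → toℕ ⟦ a ⟧ ≡ a % m
  toℕ⟦a⟧≡a%m a = toℕ-fromℕ< (m%n<n a m)

  %-≡⇒⟦⟧-≡ : ∀ {a b} → a % m ≡ b % m → ⟦ a ⟧ ≡ ⟦ b ⟧
  %-≡⇒⟦⟧-≡ {a} {b} a≡b =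
    toℕ-injective (trans (toℕ⟦a⟧≡a%m a) (trans a≡b (sym (toℕ⟦a⟧≡a%m b))))

  ⟦toℕx⟧≡x : ∀ x → ⟦ toℕ x ⟧ ≡ x
  ⟦toℕx⟧≡x x = toℕ-injective (trans (toℕ⟦a⟧≡a%m (toℕ x)) (m<n⇒m%n≡m (toℕ<n x)))

  ⟦toℕ⟦a⟧+b⟧≡⟦a+b⟧ : ∀ a b → ⟦ toℕ ⟦ a ⟧ + b ⟧ ≡ ⟦ a + b ⟧
  ⟦toℕ⟦a⟧+b⟧≡⟦a+b⟧ a b = %-≡⇒⟦⟧-≡ (begin
    (toℕ ⟦ a ⟧ + b) % m           ≡⟨ cong (λ r → (r + b) % m) (toℕ⟦a⟧≡a%m a) ⟩
    (a % m + b) % m               ≡⟨ %-distribˡ-+ (a % m) b m ⟩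
    (a % m % m + b % m) % m       ≡⟨ cong (λ r → (r + b % m) % m) (m%n%n≡m%n a m) ⟩
    (a % m + b % m) % m           ≡⟨ sym (%-distribˡ-+ a b m) ⟩
    (a + b) % m                   ∎)
    where open ≡-Reasoning

  ⟦a+m⟧≡⟦a⟧ : ∀ a → ⟦ a + m ⟧ ≡ ⟦ a ⟧
  ⟦a+m⟧≡⟦a⟧ a = %-≡⇒⟦⟧-≡ ([m+n]%n≡m%n a m)

  ⊕-comm : ∀ x y → x ⊕ y ≡ y ⊕ x
  ⊕-comm x y = cong ⟦_⟧ (+-comm (toℕ x) (toℕ y))

  ⊕-assoc : ∀ x y z → (x ⊕ y) ⊕ z ≡ x ⊕ (y ⊕ z)
  ⊕-assoc x y z = begin
    (x ⊕ y) ⊕ z                    ≡⟨ ⟦toℕ⟦a⟧+b⟧≡⟦a+b⟧ (toℕ x + toℕ y) (toℕ z) ⟩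
    ⟦ (toℕ x + toℕ y) + toℕ z ⟧    ≡⟨ cong ⟦_⟧ (trans (+-assoc (toℕ x) _ _) (+-comm (toℕ x) _)) ⟩
    ⟦ (toℕ y + toℕ z) + toℕ x ⟧    ≡⟨ ⟦toℕ⟦a⟧+b⟧≡⟦a+b⟧ (toℕ y + toℕ z) (toℕ x) ⟨
    (y ⊕ z) ⊕ x                    ≡⟨ ⊕-comm (y ⊕ z) x ⟩
    x ⊕ (y ⊕ z)                    ∎
    where open ≡-Reasoning

  [x⊖y]⊕y≡x : ∀ x y → (x ⊖ y) ⊕ y ≡ x
  [x⊖y]⊕y≡x x y = begin
    (x ⊖ y) ⊕ y                         ≡⟨ ⟦toℕ⟦a⟧+b⟧≡⟦a+b⟧ (toℕ x + (m ∸ toℕ y)) (toℕ y) ⟩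
    ⟦ (toℕ x + (m ∸ toℕ y)) + toℕ y ⟧   ≡⟨ cong ⟦_⟧ (+-assoc (toℕ x) _ _) ⟩
    ⟦ toℕ x + ((m ∸ toℕ y) + toℕ y) ⟧   ≡⟨ cong (λ r → ⟦ toℕ x + r ⟧) (m∸n+n≡m (<⇒≤ (toℕ<n y))) ⟩
    ⟦ toℕ x + m ⟧                       ≡⟨ ⟦a+m⟧≡⟦a⟧ (toℕ x) ⟩
    ⟦ toℕ x ⟧                           ≡⟨ ⟦toℕx⟧≡x x ⟩
    x                                   ∎
    where open ≡-Reasoning

  [x⊕y]⊖y≡x : ∀ x y → (x ⊕ y) ⊖ y ≡ x
  [x⊕y]⊖y≡x x y = begin
    (x ⊕ y) ⊖ y                         ≡⟨ ⟦toℕ⟦a⟧+b⟧≡⟦a+b⟧ (toℕ x + toℕ y) (m ∸ toℕ y) ⟩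
    ⟦ (toℕ x + toℕ y) + (m ∸ toℕ y) ⟧   ≡⟨ cong ⟦_⟧ (+-assoc (toℕ x) _ _) ⟩
    ⟦ toℕ x + (toℕ y + (m ∸ toℕ y)) ⟧   ≡⟨ cong (λ r → ⟦ toℕ x + r ⟧) (m+[n∸m]≡n (<⇒≤ (toℕ<n y))) ⟩
    ⟦ toℕ x + m ⟧                       ≡⟨ ⟦a+m⟧≡⟦a⟧ (toℕ x) ⟩
    ⟦ toℕ x ⟧                           ≡⟨ ⟦toℕx⟧≡x x ⟩
    x                                   ∎
    where open ≡-Reasoning

  x⊕[y⊖z]≡y⊕[x⊖z] : ∀ x y z → x ⊕ (y ⊖ z) ≡ y ⊕ (x ⊖ z)
  x⊕[y⊖z]≡y⊕[x⊖z] x y z = begin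
    x ⊕ (y ⊖ z)                  ≡⟨ cong (_⊕ (y ⊖ z)) ([x⊖y]⊕y≡x x z) ⟨
    ((x ⊖ z) ⊕ z) ⊕ (y ⊖ z)      ≡⟨ ⊕-assoc (x ⊖ z) z (y ⊖ z) ⟩
    (x ⊖ z) ⊕ (z ⊕ (y ⊖ z))      ≡⟨ cong ((x ⊖ z) ⊕_) (trans (⊕-comm z (y ⊖ z)) ([x⊖y]⊕y≡x y z)) ⟩
    (x ⊖ z) ⊕ y                  ≡⟨ ⊕-comm (x ⊖ z) y ⟩
    y ⊕ (x ⊖ z)                  ∎
    where open ≡-Reasoning

  [y⊕e]⊕[x⊖e]≡x⊕y : ∀ x y e → (y ⊕ e) ⊕ (x ⊖ e) ≡ x ⊕ y
  [y⊕e]⊕[x⊖e]≡x⊕y x y e = begin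
    (y ⊕ e) ⊕ (x ⊖ e)      ≡⟨ ⊕-assoc y e (x ⊖ e) ⟩
    y ⊕ (e ⊕ (x ⊖ e))      ≡⟨ cong (y ⊕_) (trans (⊕-comm e (x ⊖ e)) ([x⊖y]⊕y≡x x e)) ⟩
    y ⊕ x                  ≡⟨ ⊕-comm y x ⟩
    x ⊕ y                  ∎
    where open ≡-Reasoning

  module _ {X Y : Subset m} where

    ∈-sumset⁺ : ∀ {x y} → x ∈ X → y ∈ Y → x ⊕ y ∈ sumset m X Y
    ∈-sumset⁺ {x} {y} x∈X y∈Y = ∈-tabulate⁺ (to T-≡ (any⁺ _ (anyMap
      (λ { refl → any⁺ _ (anyMap (λ { refl → x,y-witness }) (∈-allFin y)) }) (∈-allFin x))))
      where
      x,y-witness : T (lookup X x ∧ (lookup Y y ∧ ⌊ x ⊕ y ≟ x ⊕ y ⌋))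
      x,y-witness = from T-∧ (∈⇒T-lookup x∈X , from T-∧ (∈⇒T-lookup y∈Y , fromWitness refl))

    ∈-sumset⁻ : ∀ {k} → k ∈ sumset m X Y → ∃[ x ] ∃[ y ] (x ∈ X × y ∈ Y × x ⊕ y ≡ k)
    ∈-sumset⁻ k∈ =
      let x , px        = satisfied (any⁻ _ (allFin m) (from T-≡ (∈-tabulate⁻ k∈)))
          y , pxy       = satisfied (any⁻ _ (allFin m) px)
          x∈X , rest    = to T-∧ pxy
          y∈Y , x⊕y≡k   = to T-∧ rest
      in x , y , T-lookup⇒∈ x∈X , T-lookup⇒∈ y∈Y , toWitness x⊕y≡k

  sumset-comm : ∀ X Y → sumset m X Y ≡ sumset m Y X
  sumset-comm X Y = ⊆-antisym (sumset-⊆-swap X Y) (sumset-⊆-swap Y X)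
    where
    sumset-⊆-swap : ∀ X Y → sumset m X Y ⊆ sumset m Y X
    sumset-⊆-swap X Y k∈ with ∈-sumset⁻ {X = X} {Y} k∈
    ... | x , y , x∈X , y∈Y , refl = subst (_∈ sumset m Y X) (⊕-comm y x) (∈-sumset⁺ y∈Y x∈X)

  ∣preimage[⊕e]∣≡∣p∣ : ∀ e p → ∣ preimage (_⊕ e) p ∣ ≡ ∣ p ∣
  ∣preimage[⊕e]∣≡∣p∣ e p =
    ∣preimage∣≡∣q∣ {q = p} (_⊕ e) (_⊖ e) (λ x → [x⊖y]⊕y≡x x e) (λ x → [x⊕y]⊖y≡x x e)

  ∣preimage[⊖e]∣≡∣p∣ : ∀ e p → ∣ preimage (_⊖ e) p ∣ ≡ ∣ p ∣
  ∣preimage[⊖e]∣≡∣p∣ e p =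
    ∣preimage∣≡∣q∣ {q = p} (_⊖ e) (_⊕ e) (λ x → [x⊕y]⊖y≡x x e) (λ x → [x⊖y]⊕y≡x x e)

  y∈Y⇒∣X∣≤∣X+Y∣ : ∀ X {Y y} → y ∈ Y → ∣ X ∣ ≤ ∣ sumset m X Y ∣
  y∈Y⇒∣X∣≤∣X+Y∣ X {Y} {y} y∈Y = begin
    ∣ X ∣                              ≤⟨ p⊆q⇒∣p∣≤∣q∣ X⊆X+Y-y ⟩
    ∣ preimage (_⊕ y) (sumset m X Y) ∣ ≡⟨ ∣preimage[⊕e]∣≡∣p∣ y (sumset m X Y) ⟩
    ∣ sumset m X Y ∣                   ∎
    where
    open ≤-Reasoning
    X⊆X+Y-y : X ⊆ preimage (_⊕ y) (sumset m X Y)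
    X⊆X+Y-y x∈X = ∈-preimage⁺ (_⊕ y) (∈-sumset⁺ {X = X} {Y} x∈X y∈Y)

  orbit : Fin m → Fin m → ℕ → Fin m
  orbit x t i = ⟦ toℕ x + i * toℕ t ⟧

  orbit-suc : ∀ x t i → orbit x t (suc i) ≡ orbit x t i ⊕ t
  orbit-suc x t i = sym (trans (⟦toℕ⟦a⟧+b⟧≡⟦a+b⟧ (toℕ x + i * toℕ t) (toℕ t))
    (cong ⟦_⟧ (trans (+-assoc (toℕ x) _ _) (cong (toℕ x +_) (+-comm (i * toℕ t) (toℕ t))))))

  orbit-⊆ : ∀ {X x t} → x ∈ X → (∀ {z} → z ∈ X → z ⊕ t ∈ X) → ∀ i → orbit x t i ∈ X
  orbit-⊆ {X} {x} x∈X X+t⊆X zero =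
    subst (_∈ X) (sym (trans (cong ⟦_⟧ (+-identityʳ (toℕ x))) (⟦toℕx⟧≡x x))) x∈X
  orbit-⊆ {X} {x} {t} x∈X X+t⊆X (suc i) =
    subst (_∈ X) (sym (orbit-suc x t i)) (X+t⊆X (orbit-⊆ x∈X X+t⊆X i))

  orbit-≡⇒m∣k*t : ∀ x t i k → orbit x t i ≡ orbit x t (i + k) → m ∣ k * toℕ t
  orbit-≡⇒m∣k*t x t i k eq = m%d≡[m+n]%d⇒d∣n (toℕ x + i * toℕ t) (k * toℕ t) (begin
    (toℕ x + i * toℕ t) % m                ≡⟨ toℕ⟦a⟧≡a%m _ ⟨
    toℕ (orbit x t i)                      ≡⟨ cong toℕ eq ⟩
    toℕ (orbit x t (i + k))                ≡⟨ toℕ⟦a⟧≡a%m _ ⟩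
    (toℕ x + (i + k) * toℕ t) % m          ≡⟨ cong (λ r → (toℕ x + r) % m) (*-distribʳ-+ (toℕ t) i k) ⟩
    (toℕ x + (i * toℕ t + k * toℕ t)) % m  ≡⟨ cong (_% m) (+-assoc (toℕ x) _ _) ⟨
    (toℕ x + i * toℕ t + k * toℕ t) % m    ∎)
    where open ≡-Reasoning

  -- With m = q · gcd(m, t), the points x, x + t, …, x + (q − 1)t are pairwise distinct.
  translation-invariant⇒m≤gcd*∣X∣ : ∀ {X x t} → x ∈ X → (∀ {z} → z ∈ X → z ⊕ t ∈ X) →
    m ≤ gcd m (toℕ t) * ∣ X ∣
  translation-invariant⇒m≤gcd*∣X∣ {X} {x} {t} x∈X X+t⊆X with gcd[m,n]∣m m (toℕ t)
  ... | divides q m≡q*g = begin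
    m                      ≡⟨ m≡q*g ⟩
    q * gcd m (toℕ t)      ≤⟨ *-monoˡ-≤ (gcd m (toℕ t)) q≤∣X∣ ⟩
    ∣ X ∣ * gcd m (toℕ t)  ≡⟨ *-comm ∣ X ∣ _ ⟩
    gcd m (toℕ t) * ∣ X ∣  ∎
    where
    open ≤-Reasoning
    orbit-distinct : ∀ {i j : Fin q} → toℕ i < toℕ j → orbit x t (toℕ i) ≢ orbit x t (toℕ j)
    orbit-distinct {i} {j} i<j eq =
      <⇒≱ k<q (∣⇒≤ (m≡q*gcd[m,n]⇒m∣k*n⇒q∣k m≡q*g (orbit-≡⇒m∣k*t x t (toℕ i) k eq′)))
      where
      k = toℕ j ∸ toℕ i
      instance
        k≢0 : NonZero k
        k≢0 = >-nonZero (m<n⇒0<n∸m i<j)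
      k<q : k < q
      k<q = ≤-<-trans (m∸n≤m (toℕ j) (toℕ i)) (toℕ<n j)
      eq′ : orbit x t (toℕ i) ≡ orbit x t (toℕ i + k)
      eq′ = trans eq (cong (orbit x t) (sym (m+[n∸m]≡n (<⇒≤ i<j))))
    orbit-injective : Injective _≡_ _≡_ (orbit x t ∘ toℕ {q})
    orbit-injective {i} {j} eq with <-cmp (toℕ i) (toℕ j)
    ... | tri< i<j _ _ = contradiction eq (orbit-distinct i<j)
    ... | tri≈ _ i≡j _ = toℕ-injective i≡j
    ... | tri> _ _ j<i = contradiction (sym eq) (orbit-distinct j<i)
    q≤∣X∣ : q ≤ ∣ X ∣
    q≤∣X∣ = subst (_≤ ∣ X ∣) (∣⊤∣≡n q)
      (injection⇒∣p∣≤∣q∣ {p = ⊤} (orbit x t ∘ toℕ) orbit-injective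
        (λ {i} _ → orbit-⊆ x∈X X+t⊆X (toℕ i)))

  Anchored : ℕ → Subset m → Fin m → Set
  Anchored d Z z₀ = z₀ ∈ Z × (∀ z → z ∈ Z → z ≢ z₀ → gcdDiff m z z₀ ≤ d)

  -- |X + Y| ≥ min(m / d, |X| + |Y| − 1), multiplied through by d.
  SumsetBound : ℕ → Subset m → Subset m → Set
  SumsetBound d X Y = m ⊓ (d * (∣ X ∣ + ∣ Y ∣ ∸ 1)) ≤ d * ∣ sumset m X Y ∣

  module e-transform (X Y : Subset m) (e : Fin m) where

    Y+e : Subset m
    Y+e = preimage (_⊖ e) Y

    X-e : Subset m
    X-e = preimage (_⊕ e) X

    X⁺ : Subset m
    X⁺ = X ∪ Y+e

    Y⁻ : Subset m
    Y⁻ = Y ∩ X-e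

    Y⁻+e : Subset m
    Y⁻+e = preimage (_⊖ e) Y⁻

    X∩[Y+e]≡Y⁻+e : X ∩ Y+e ≡ Y⁻+e
    X∩[Y+e]≡Y⁻+e = ⊆-antisym X∩[Y+e]⊆Y⁻+e Y⁻+e⊆X∩[Y+e]
      where
      X∩[Y+e]⊆Y⁻+e : X ∩ Y+e ⊆ Y⁻+e
      X∩[Y+e]⊆Y⁻+e {w} w∈ with x∈p∩q⁻ X Y+e w∈
      ... | w∈X , w⊖e∈Y = ∈-preimage⁺ (_⊖ e) {Y⁻} (x∈p∩q⁺ (∈-preimage⁻ (_⊖ e) w⊖e∈Y ,
                            ∈-preimage⁺ (_⊕ e) {X} (subst (_∈ X) (sym ([x⊖y]⊕y≡x w e)) w∈X)))
      Y⁻+e⊆X∩[Y+e] : Y⁻+e ⊆ X ∩ Y+e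
      Y⁻+e⊆X∩[Y+e] {w} w∈ with x∈p∩q⁻ Y X-e (∈-preimage⁻ (_⊖ e) w∈)
      ... | w⊖e∈Y , w⊖e∈X-e = x∈p∩q⁺ (subst (_∈ X) ([x⊖y]⊕y≡x w e) (∈-preimage⁻ (_⊕ e) w⊖e∈X-e) ,
                                       ∈-preimage⁺ (_⊖ e) w⊖e∈Y)

    ∣X⁺∣+∣Y⁻∣≡∣X∣+∣Y∣ : ∣ X⁺ ∣ + ∣ Y⁻ ∣ ≡ ∣ X ∣ + ∣ Y ∣
    ∣X⁺∣+∣Y⁻∣≡∣X∣+∣Y∣ = begin
      ∣ X⁺ ∣ + ∣ Y⁻ ∣         ≡⟨ cong (∣ X⁺ ∣ +_) (∣preimage[⊖e]∣≡∣p∣ e Y⁻) ⟨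
      ∣ X⁺ ∣ + ∣ Y⁻+e ∣       ≡⟨ cong (λ p → ∣ X⁺ ∣ + ∣ p ∣) X∩[Y+e]≡Y⁻+e ⟨
      ∣ X⁺ ∣ + ∣ X ∩ Y+e ∣    ≡⟨ ∣p∪q∣+∣p∩q∣≡∣p∣+∣q∣ X Y+e ⟩
      ∣ X ∣ + ∣ Y+e ∣         ≡⟨ cong (∣ X ∣ +_) (∣preimage[⊖e]∣≡∣p∣ e Y) ⟩
      ∣ X ∣ + ∣ Y ∣           ∎
      where open ≡-Reasoning

    X⁺+Y⁻⊆X+Y : sumset m X⁺ Y⁻ ⊆ sumset m X Y
    X⁺+Y⁻⊆X+Y k∈ with ∈-sumset⁻ {X = X⁺} {Y⁻} k∈
    ... | a , b , a∈X⁺ , b∈Y⁻ , refl with x∈p∩q⁻ Y X-e b∈Y⁻ | x∈p∪q⁻ X Y+e a∈X⁺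
    ...   | b∈Y , _     | inj₁ a∈X   = ∈-sumset⁺ a∈X b∈Y
    ...   | _ , b∈X-e   | inj₂ a∈Y+e = subst (_∈ sumset m X Y) ([y⊕e]⊕[x⊖e]≡x⊕y a b e)
      (∈-sumset⁺ (∈-preimage⁻ (_⊕ e) {X} b∈X-e) (∈-preimage⁻ (_⊖ e) {Y} a∈Y+e))

    SumsetBound-transform : ∀ d → SumsetBound d X⁺ Y⁻ → SumsetBound d X Y
    SumsetBound-transform d bound = begin
      m ⊓ (d * (∣ X ∣ + ∣ Y ∣ ∸ 1))     ≡⟨ cong (λ s → m ⊓ (d * (s ∸ 1))) ∣X⁺∣+∣Y⁻∣≡∣X∣+∣Y∣ ⟨
      m ⊓ (d * (∣ X⁺ ∣ + ∣ Y⁻ ∣ ∸ 1))   ≤⟨ bound ⟩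
      d * ∣ sumset m X⁺ Y⁻ ∣            ≤⟨ *-monoʳ-≤ d (p⊆q⇒∣p∣≤∣q∣ X⁺+Y⁻⊆X+Y) ⟩
      d * ∣ sumset m X Y ∣              ∎
      where open ≤-Reasoning

  invariant⇒SumsetBound : ∀ {d X Y y₀} → Nonempty X → Anchored d Y y₀ →
    (∀ {x y} → x ∈ X → y ∈ Y → y ⊕ (x ⊖ y₀) ∈ X) → SumsetBound d X Y
  invariant⇒SumsetBound {d} {X} {Y} {y₀} (x , x∈X) (y₀∈Y , gcd≤d) X+[Y-y₀]⊆X
    with any? (λ y → y ∈? Y ×-dec ¬? (y ≟ y₀))
  ... | yes (y , y∈Y , y≢y₀) = ≤-trans (m⊓n≤m m _) (begin
    m                                ≤⟨ translation-invariant⇒m≤gcd*∣X∣ x∈X X+[y-y₀]⊆X ⟩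
    gcd m (toℕ (y ⊖ y₀)) * ∣ X ∣     ≤⟨ *-monoˡ-≤ ∣ X ∣ (gcd≤d y y∈Y y≢y₀) ⟩
    d * ∣ X ∣                        ≤⟨ *-monoʳ-≤ d (y∈Y⇒∣X∣≤∣X+Y∣ X y₀∈Y) ⟩
    d * ∣ sumset m X Y ∣             ∎)
    where
    open ≤-Reasoning
    X+[y-y₀]⊆X : ∀ {z} → z ∈ X → z ⊕ (y ⊖ y₀) ∈ X
    X+[y-y₀]⊆X z∈X = subst (_∈ X) (x⊕[y⊖z]≡y⊕[x⊖z] y _ y₀) (X+[Y-y₀]⊆X z∈X y∈Y)
  ... | no ∄y≢y₀ = ≤-trans (m⊓n≤n m _) (*-monoʳ-≤ d (begin
    ∣ X ∣ + ∣ Y ∣ ∸ 1     ≤⟨ ∸-monoˡ-≤ 1 (+-monoʳ-≤ ∣ X ∣ ∣Y∣≤1) ⟩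
    ∣ X ∣ + 1 ∸ 1         ≡⟨ m+n∸n≡m ∣ X ∣ 1 ⟩
    ∣ X ∣                 ≤⟨ y∈Y⇒∣X∣≤∣X+Y∣ X y₀∈Y ⟩
    ∣ sumset m X Y ∣      ∎))
    where
    open ≤-Reasoning
    Y⊆⁅y₀⁆ : Y ⊆ ⁅ y₀ ⁆
    Y⊆⁅y₀⁆ {y} y∈Y with y ≟ y₀
    ... | yes refl = x∈⁅x⁆ y₀
    ... | no y≢y₀  = contradiction (y , y∈Y , y≢y₀) ∄y≢y₀
    ∣Y∣≤1 : ∣ Y ∣ ≤ 1
    ∣Y∣≤1 = subst (∣ Y ∣ ≤_) (∣⁅x⁆∣≡1 y₀) (p⊆q⇒∣p∣≤∣q∣ Y⊆⁅y₀⁆)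

  sumset-bound : ∀ d {X Y y₀} → Nonempty X → Anchored d Y y₀ → SumsetBound d X Y
  sumset-bound d {Y = Y} = bound-within ∣ Y ∣ ≤-refl
    where
    bound-within : ∀ n {X Y y₀} → ∣ Y ∣ ≤ n → Nonempty X → Anchored d Y y₀ → SumsetBound d X Y
    bound-within zero ∣Y∣≤0 _ (y₀∈Y , _) =
      contradiction ∣Y∣≤0 (<⇒≱ (≤-<-trans z≤n (x∈p⇒∣p-x∣<∣p∣ y₀∈Y)))
    bound-within (suc n) {X} {Y} {y₀} ∣Y∣≤1+n X≢∅ anc@(y₀∈Y , gcd≤d)
      with any? (λ x → x ∈? X ×-dec any? (λ z → z ∈? Y ×-dec ¬? (z ⊕ (x ⊖ y₀) ∈? X)))
    ... | no ∄escape = invariant⇒SumsetBound X≢∅ anc λ {x} {y} x∈X y∈Y →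
      decidable-stable (_ ∈? X) (λ ∉X → ∄escape (x , x∈X , y , y∈Y , ∉X))
    ... | yes (x , x∈X , z , z∈Y , z⊕e∉X) =
      SumsetBound-transform d (bound-within n ∣Y⁻∣≤n (x , x∈p∪q⁺ (inj₁ x∈X)) (y₀∈Y⁻ , gcd≤d′))
      where
      open e-transform X Y (x ⊖ y₀)
      y₀∈Y⁻ : y₀ ∈ Y⁻
      y₀∈Y⁻ = x∈p∩q⁺ (y₀∈Y , ∈-preimage⁺ (_⊕ (x ⊖ y₀)) {X}
                (subst (_∈ X) (sym (trans (⊕-comm y₀ _) ([x⊖y]⊕y≡x x y₀))) x∈X))
      gcd≤d′ : ∀ y → y ∈ Y⁻ → y ≢ y₀ → gcdDiff m y y₀ ≤ d
      gcd≤d′ y y∈Y⁻ = gcd≤d y (p∩q⊆p Y X-e y∈Y⁻)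
      z∉Y⁻ : z ∉ Y⁻
      z∉Y⁻ = z⊕e∉X ∘ ∈-preimage⁻ (_⊕ (x ⊖ y₀)) {X} ∘ proj₂ ∘ x∈p∩q⁻ Y X-e
      ∣Y⁻∣≤n : ∣ Y⁻ ∣ ≤ n
      ∣Y⁻∣≤n = ≤-pred (≤-trans (p⊂q⇒∣p∣<∣q∣ (p∩q⊆p Y X-e , z , z∈Y , z∉Y⁻)) ∣Y∣≤1+n)

  sumset-bound′ : ∀ d {X Y x₀} → Nonempty Y → Anchored d X x₀ → SumsetBound d X Y
  sumset-bound′ d {X} {Y} Y≢∅ anc =
    subst₂ (λ s S → m ⊓ (d * (s ∸ 1)) ≤ d * ∣ S ∣) (+-comm ∣ Y ∣ ∣ X ∣) (sumset-comm Y X)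
      (sumset-bound d Y≢∅ anc)

  ∈-elems⁺ : ∀ {Z : Subset m} {z} → z ∈ Z → z ∈ˡ elems Z
  ∈-elems⁺ {Z} z∈Z = ∈-filter⁺ (λ z → lookup Z z ≟ᵇ true) (∈-allFin _) ([]=⇒lookup z∈Z)

  ∈-elems⁻ : ∀ {Z : Subset m} {z} → z ∈ˡ elems Z → z ∈ Z
  ∈-elems⁻ {Z} {z} z∈elems =
    lookup⇒[]= z Z (proj₂ (∈-filter⁻ (λ z → lookup Z z ≟ᵇ true) {xs = allFin m} z∈elems))

  gcdDiff≤maxGcd : ∀ {Z z z₀} → z ∈ Z → z ≢ z₀ → gcdDiff m z z₀ ≤ maxGcd m Z z₀
  gcdDiff≤maxGcd {Z} {z} {z₀} z∈Z z≢z₀ =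
    subst (_≤ maxGcd m Z z₀) gcd-if-z≢z₀ (∈⇒≤foldr-⊔ gcd-if (elems Z) (∈-elems⁺ z∈Z))
    where
    gcd-if : Fin m → ℕ
    gcd-if z = if ⌊ z ≟ z₀ ⌋ then 0 else gcdDiff m z z₀
    gcd-if-z≢z₀ : gcd-if z ≡ gcdDiff m z z₀
    gcd-if-z≢z₀ with z ≟ z₀
    ... | yes z≡z₀ = contradiction z≡z₀ z≢z₀
    ... | no _     = refl

  ∣Z∣≡1⇒Anchored : ∀ {d Z z₀} → ∣ Z ∣ ≡ 1 → z₀ ∈ Z → Anchored d Z z₀
  ∣Z∣≡1⇒Anchored ∣Z∣≡1 z₀∈Z = z₀∈Z , λ z z∈Z z≢z₀ →
    contradiction ∣Z∣≡1 (>⇒≢ (x∈p∧y∈p∧x≢y⇒1<∣p∣ z∈Z z₀∈Z z≢z₀))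

  min-maxGcd-anchored : ∀ Z → Nonempty Z →
    ∃[ z₀ ] Anchored (foldr _⊓_ m (map (maxGcd m Z) (elems Z))) Z z₀
  min-maxGcd-anchored Z (w , w∈Z) with foldr-⊓-selective (maxGcd m Z) m (elems Z)
  ... | inj₁ min≡m = w , w∈Z , λ z _ _ →
    subst (gcdDiff m z w ≤_) (sym min≡m) (∣⇒≤ (gcd[m,n]∣m m _))
  ... | inj₂ (z₀ , z₀∈elems , min≡maxGcd[z₀]) = z₀ , ∈-elems⁻ z₀∈elems , λ z z∈Z z≢z₀ →
    subst (gcdDiff m z z₀ ≤_) (sym min≡maxGcd[z₀]) (gcdDiff≤maxGcd z∈Z z≢z₀)

  δ-anchored : ∀ Z → Nonempty Z → ∃[ z₀ ] Anchored (δ m Z) Z z₀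
  δ-anchored Z Z≢∅@(w , w∈Z) with ∣ Z ∣ ≡ᵇ 1 in ∣Z∣≡ᵇ1
  ... | true  = w , ∣Z∣≡1⇒Anchored (≡ᵇ⇒≡ ∣ Z ∣ 1 (subst T (sym ∣Z∣≡ᵇ1) _)) w∈Z
  ... | false = min-maxGcd-anchored Z Z≢∅

  unit-gcd⇒Anchored : ∀ {Z z₀} → z₀ ∈ Z → (∀ z → z ∈ Z → z ≢ z₀ → gcdDiff m z z₀ ≡ 1) →
    Anchored 1 Z z₀
  unit-gcd⇒Anchored z₀∈Z gcd≡1 = z₀∈Z , λ z z∈Z z≢z₀ → ≤-reflexive (gcd≡1 z z∈Z z≢z₀)

  SumsetBound-1 : ∀ {X Y} → SumsetBound 1 X Y → m ⊓ (∣ X ∣ + ∣ Y ∣ ∸ 1) ≤ ∣ sumset m X Y ∣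
  SumsetBound-1 = subst₂ (λ s S → m ⊓ s ≤ S) (*-identityˡ _) (*-identityˡ _)

corollary2p9 : (m : ℕ) .{{_ : NonZero m}} (X Y : Subset m) → Nonempty X → Nonempty Y →
    (m ⊓ ((δ m X ⊓ δ m Y) * (∣ X ∣ + ∣ Y ∣ ∸ 1)) ≤ (δ m X ⊓ δ m Y) * ∣ sumset m X Y ∣)
    × ((∃[ y₀ ] (y₀ ∈ Y × (∀ y → y ∈ Y → y ≢ y₀ → gcdDiff m y y₀ ≡ 1)))
        → m ⊓ (∣ X ∣ + ∣ Y ∣ ∸ 1) ≤ ∣ sumset m X Y ∣)
    × ((∃[ x₀ ] (x₀ ∈ X × (∀ x → x ∈ X → x ≢ x₀ → gcdDiff m x x₀ ≡ 1)))
        → m ⊓ (∣ X ∣ + ∣ Y ∣ ∸ 1) ≤ ∣ sumset m X Y ∣)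
corollary2p9 m X Y X≢∅ Y≢∅ =
  δ-bound ,
  (λ (y₀ , y₀∈Y , gcd≡1) →
     SumsetBound-1 {X = X} {Y} (sumset-bound 1 X≢∅ (unit-gcd⇒Anchored y₀∈Y gcd≡1))) ,
  (λ (x₀ , x₀∈X , gcd≡1) →
     SumsetBound-1 {X = X} {Y} (sumset-bound′ 1 Y≢∅ (unit-gcd⇒Anchored x₀∈X gcd≡1)))
  where
  δ-bound : SumsetBound (δ m X ⊓ δ m Y) X Y
  δ-bound with ⊓-sel (δ m X) (δ m Y) | δ-anchored X X≢∅ | δ-anchored Y Y≢∅
  ... | inj₁ min≡δX | _ , X-anchored | _ =
    sumset-bound′ _ Y≢∅ (subst (λ d → Anchored d X _) (sym min≡δX) X-anchored)
  ... | inj₂ min≡δY | _ | _ , Y-anchored =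
    sumset-bound _ X≢∅ (subst (λ d → Anchored d Y _) (sym min≡δY) Y-anchored)
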